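{- If a triangle-free oriented graph $G$ has a cut vertex, then either $G$ has a full in-star cutset, or $G$ has a vertex of degree at most $1$.
   Context: Oriented graphs have no loops, no multiple arcs and no pair of opposite arcs; degree, triangles, connectivity and cut vertices refer to the underlying graph. $N^-[v]$ denotes $v$ together with its in-neighbours. A full in-star cutset of $G$ is a set $N^-[v]$, $v\in V(G)$, such that $G\setminus N^-[v]$ is disconnected. -}

module Defs where

open import Data.Nat using (ℕ; _≤_)
open import Data.Fin using (Fin)
open import Data.Bool using (Bool; true; false)
open import Data.List using (length; filter)
open import Data.Empty using (⊥)
open import Data.Unit using (⊤)
open import Data.List using (allFin)
open import Data.Product using (Σ; _×_; ∃; ∃-syntax)
open import Data.Sum using (_⊎_)
open import Relation.Nullary using (¬_; Dec)
open import Relation.Binary.PropositionalEquality using (_≡_; _≢_)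
import Data.Bool.Properties as BP
open import Relation.Nullary.Decidable using (_⊎-dec_)

record Digraph (n : ℕ) : Set where
  field
    arc : Fin n → Fin n → Bool

open Digraph public

Arc : ∀ {n} → Digraph n → Fin n → Fin n → Set
Arc G u v = arc G u v ≡ true

-- Oriented graph: no loops, no pair of opposite arcs
-- (multiple arcs are excluded by the representation).
IsOriented : ∀ {n} → Digraph n → Set
IsOriented {n} G =
  ((v : Fin n) → ¬ Arc G v v) ×
  ((u v : Fin n) → Arc G u v → ¬ Arc G v u)

Adj : ∀ {n} → Digraph n → Fin n → Fin n → Set
Adj G u v = Arc G u v ⊎ Arc G v u

adj? : ∀ {n} (G : Digraph n) (u v : Fin n) → Dec (Adj G u v)
adj? G u v = (arc G u v BP.≟ true) ⊎-dec (arc G v u BP.≟ true)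

degree : ∀ {n} → Digraph n → Fin n → ℕ
degree {n} G v = length (filter (adj? G v) (allFin n))

TriangleFree : ∀ {n} → Digraph n → Set
TriangleFree {n} G =
  (a b c : Fin n) → Adj G a b → Adj G b c → Adj G a c → ⊥

-- u and w are joined by a path (in the underlying graph) all of whose
-- vertices lie in the vertex set S (i.e. in the induced subgraph G[S]).
data Conn {n} (G : Digraph n) (S : Fin n → Set) : Fin n → Fin n → Set where
  here : ∀ {u} → S u → Conn G S u u
  step : ∀ {u v w} → S u → Adj G u v → Conn G S v w → Conn G S u w

DisconnectedWithout : ∀ {n} → Digraph n → (Fin n → Set) → Set
DisconnectedWithout {n} G X =
  ∃[ u ] ∃[ w ] (¬ X u × ¬ X w × ¬ Conn G (λ x → ¬ X x) u w)

-- v is a cut vertex: deleting v increases the number of components, i.e.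
-- some two vertices other than v are connected in G but not in G - v.
IsCutVertex : ∀ {n} → Digraph n → Fin n → Set
IsCutVertex {n} G v =
  ∃[ u ] ∃[ w ] (u ≢ v × w ≢ v × Conn G (λ _ → ⊤) u w
                 × ¬ Conn G (λ x → x ≢ v) u w)

HasCutVertex : ∀ {n} → Digraph n → Set
HasCutVertex {n} G = ∃[ v ] IsCutVertex G v

InClosed : ∀ {n} → Digraph n → Fin n → Fin n → Set
InClosed G v x = x ≡ v ⊎ Arc G x v

HasFullInStarCutset : ∀ {n} → Digraph n → Set
HasFullInStarCutset {n} G = ∃[ v ] DisconnectedWithout G (InClosed G v)

-- Let v be a cut vertex separating u from w. Each of u, w is joined in G - v to a
-- vertex outside N⁻[v]: to itself if it is not an in-neighbour of v, and otherwise,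
-- unless its degree is at most 1, to a neighbour x ≠ v, which cannot be an
-- in-neighbour of v because u, x, v would form a triangle. A path between these two
-- vertices avoiding N⁻[v] would join u to w in G - v, so N⁻[v] is a cutset.
module Submission where

open import Defs
open import Data.Nat using (ℕ; _≤_; s≤s; _≤?_)
open import Data.Nat.Properties using (≰⇒>)
open import Data.Fin using (Fin)
open import Data.Fin.Properties using (_≟_)
open import Data.Bool using (true)
open import Data.Bool.Properties as Bool using ()
open import Data.Product using (∃-syntax; _,_; _×_; proj₂)
open import Data.Sum using (_⊎_; inj₁; inj₂; swap)
open import Data.List using (List; _∷_; length; filter; allFin)
open import Data.List.Relation.Unary.All using (_∷_)
open import Data.List.Relation.Unary.AllPairs using (_∷_)
open import Data.List.Relation.Unary.Any using (here; there)
open import Data.List.Relation.Unary.Unique.Propositional using (Unique)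
open import Data.List.Relation.Unary.Unique.Propositional.Properties using (allFin⁺; filter⁺)
open import Data.List.Membership.Propositional using (_∈_)
open import Data.List.Membership.Propositional.Properties using (∈-filter⁻)
open import Relation.Nullary using (¬_; yes; no)
open import Relation.Binary.Definitions using (DecidableEquality)
open import Relation.Binary.PropositionalEquality using (_≢_; refl; sym)

module _ {A : Set} (_≟ᴬ_ : DecidableEquality A) where

  Unique∧2≤length⇒∃-∈-≢ : ∀ {ys : List A} → Unique ys → 2 ≤ length ys →
                          (v : A) → ∃[ y ] y ∈ ys × y ≢ v
  Unique∧2≤length⇒∃-∈-≢ {a ∷ b ∷ _} ((a≢b ∷ _) ∷ _) (s≤s (s≤s _)) v with a ≟ᴬ v
  ... | no a≢v = a , here refl , a≢v
  ... | yes refl = b , there (here refl) , λ b≡a → a≢b (sym b≡a)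

module _ {n : ℕ} {G : Digraph n} where

  Conn-mono : ∀ {S T : Fin n → Set} {a b} → (∀ {x} → S x → T x) →
              Conn G S a b → Conn G T a b
  Conn-mono f (here s) = here (f s)
  Conn-mono f (step s adj c) = step (f s) adj (Conn-mono f c)

  Conn-trans : ∀ {S a b c} → Conn G S a b → Conn G S b c → Conn G S a c
  Conn-trans (here _) d = d
  Conn-trans (step s adj c) d = step s adj (Conn-trans c d)

  Conn-start : ∀ {S a b} → Conn G S a b → S a
  Conn-start (here s) = s
  Conn-start (step s _ _) = s

  Conn-sym : ∀ {S a b} → Conn G S a b → Conn G S b a
  Conn-sym (here s) = here s
  Conn-sym (step s adj c) = Conn-trans (Conn-sym c) (step (Conn-start c) (swap adj) (here s))

2≤degree⇒neighbour-≢ : ∀ {n} (G : Digraph n) {u : Fin n} → 2 ≤ degree G u →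
                       (v : Fin n) → ∃[ x ] Adj G u x × x ≢ v
2≤degree⇒neighbour-≢ {n} G {u} 2≤deg v
  with Unique∧2≤length⇒∃-∈-≢ _≟_ (filter⁺ (adj? G u) (allFin⁺ n)) 2≤deg v
... | x , x∈nbrs , x≢v = x , proj₂ (∈-filter⁻ (adj? G u) {xs = allFin n} x∈nbrs) , x≢v

reaches-outside-InClosed : ∀ {n} (G : Digraph n) → TriangleFree G → {u v : Fin n} → u ≢ v →
  (∃[ x ] degree G x ≤ 1) ⊎ (∃[ u' ] ¬ InClosed G v u' × Conn G (λ x → x ≢ v) u u')
reaches-outside-InClosed G tf {u} {v} u≢v with arc G u v Bool.≟ true
... | no ¬u→v = inj₂ (u , u∉N⁻[v] , here u≢v)
  where
    u∉N⁻[v] : ¬ InClosed G v u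
    u∉N⁻[v] (inj₁ u≡v) = u≢v u≡v
    u∉N⁻[v] (inj₂ u→v) = ¬u→v u→v
... | yes u→v with degree G u ≤? 1
...   | yes deg≤1 = inj₁ (u , deg≤1)
...   | no deg≰1 with 2≤degree⇒neighbour-≢ G (≰⇒> deg≰1) v
...     | x , u~x , x≢v = inj₂ (x , x∉N⁻[v] , step u≢v u~x (here x≢v))
  where
    x∉N⁻[v] : ¬ InClosed G v x
    x∉N⁻[v] (inj₁ x≡v) = x≢v x≡v
    x∉N⁻[v] (inj₂ x→v) = tf u x v u~x (inj₁ x→v) (inj₁ u→v)

lemma5p4 : {n : ℕ} (G : Digraph n) → IsOriented G → TriangleFree G →
    HasCutVertex G → HasFullInStarCutset G ⊎ (∃[ v ] degree G v ≤ 1)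
lemma5p4 G _ tf (v , u , w , u≢v , w≢v , _ , u↮w)
  with reaches-outside-InClosed G tf u≢v | reaches-outside-InClosed G tf w≢v
... | inj₁ low | _ = inj₂ low
... | inj₂ _ | inj₁ low = inj₂ low
... | inj₂ (u' , u'∉ , u↝u') | inj₂ (w' , w'∉ , w↝w') =
  inj₁ (v , u' , w' , u'∉ , w'∉ , λ u'↝w' →
    u↮w (Conn-trans u↝u' (Conn-trans (Conn-mono avoids-v u'↝w') (Conn-sym w↝w'))))
  where
    avoids-v : ∀ {x} → ¬ InClosed G v x → x ≢ v
    avoids-v x∉ x≡v = x∉ (inj₁ x≡v)
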